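{- Let $n,k$ be even integers with $1\le k<n/2$, $\gcd(n,k)=2$ and $4\nmid n$. Then (a) $\lambda\in A(n,k)$ if and only if $k^2\equiv1\pmod{n/2}$; (b) $\tau\in A(n,k)$ if and only if $k^2\equiv-1\pmod{n/2}$. Moreover, if $\lambda\in A(n,k)$ then $\lambda\in B(n,k)$, and if $\tau\in A(n,k)$ then $\tau\in B(n,k)$.
   Context: $\mathrm{DGP}(n,k)$ is the canonical double cover of the generalized Petersen graph $\mathrm{GP}(n,k)$: vertex set $\{(u_i,j),(v_i,j): 0\le i\le n-1, j\in\{0,1\}\}$ with edges $\{(u_i,j),(u_{i+1},1-j)\}$, $\{(u_i,j),(v_i,1-j)\}$ (spokes, forming the set $\mathcal{S}$), $\{(v_i,j),(v_{i+k},1-j)\}$, subscripts mod $n$. $A(n,k)=\mathrm{Aut}(\mathrm{DGP}(n,k))$ and $B(n,k)$ is the setwise stabilizer of $\mathcal{S}$ in $A(n,k)$. The permutations $\lambda,\tau$ of the vertex set are defined by: $((u_i,j)^\lambda,(v_i,j)^\lambda)=((v_{1+(i-k)k},j),(u_{ik},j))$ if $i+j$ is odd and $=((v_{ik},j),(u_{1+(i-k)k},j))$ if $i+j$ is even; $((u_i,j)^\tau,(v_i,j)^\tau)=((v_{ -1+(i-k)k},j),(u_{ik},j))$ if $i+j$ is odd and $=((v_{ik},j),(u_{ -1+(i-k)k},j))$ if $i+j$ is even (subscripts mod $n$). -}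

module Defs where

open import Data.Nat as ℕ using (ℕ; zero; suc; _%_)
open import Data.Fin as Fin using (Fin; toℕ; fromℕ<)
open import Data.Integer as ℤ using (ℤ; +_; _%ℕ_)
open import Data.Integer.DivMod using (n%ℕd<d)
open import Data.Bool using (Bool; true; false; if_then_else_)
open import Data.Product using (_×_)
open import Data.Sum using (_⊎_)
open import Relation.Binary.PropositionalEquality using (_≡_)
open import Function.Definitions using (Bijective)
open import Function.Bundles using (_⇔_)

data V (n : ℕ) : Set where
  u : Fin n → Fin 2 → V n
  v : Fin n → Fin 2 → V n

flip : Fin 2 → Fin 2
flip Fin.zero = Fin.suc Fin.zero
flip (Fin.suc _) = Fin.zero

-- reduce an integer subscript modulo n (n > 0 is witnessed by an index i : Fin n)
ix : {n : ℕ} → Fin n → ℤ → Fin n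
ix {suc m} _ z = fromℕ< (n%ℕd<d z (suc m))

zi : {n : ℕ} → Fin n → ℤ
zi i = + toℕ i

shift : {n : ℕ} → Fin n → ℤ → Fin n
shift i c = ix i (zi i ℤ.+ c)

data E (n k : ℕ) : V n → V n → Set where
  outer : ∀ i j → E n k (u i j) (u (shift i (+ 1)) (flip j))
  spoke : ∀ i j → E n k (u i j) (v i (flip j))
  inner : ∀ i j → E n k (v i j) (v (shift i (+ k)) (flip j))

Adj : (n k : ℕ) → V n → V n → Set
Adj n k x y = E n k x y ⊎ E n k y x

data SpokeGen (n : ℕ) : V n → V n → Set where
  sp : ∀ i j → SpokeGen n (u i j) (v i (flip j))

Spoke : (n : ℕ) → V n → V n → Set
Spoke n x y = SpokeGen n x y ⊎ SpokeGen n y x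

InA : (n k : ℕ) → (V n → V n) → Set
InA n k σ = Bijective _≡_ _≡_ σ × (∀ x y → Adj n k x y ⇔ Adj n k (σ x) (σ y))

InB : (n k : ℕ) → (V n → V n) → Set
InB n k σ = InA n k σ × (∀ x y → Spoke n x y ⇔ Spoke n (σ x) (σ y))

oddSum : {n : ℕ} → Fin n → Fin 2 → Bool
oddSum i j with (toℕ i ℕ.+ toℕ j) % 2
... | zero = false
... | suc _ = true

a : (k : ℕ) → {n : ℕ} → ℤ → Fin n → Fin n
a k ε i = ix i (ε ℤ.+ (zi i ℤ.- + k) ℤ.* + k)

b : (k : ℕ) → {n : ℕ} → Fin n → Fin n
b k i = ix i (zi i ℤ.* + k)

perm : (n k : ℕ) → ℤ → V n → V n
perm n k ε (u i j) = if oddSum i j then v (a k ε i) j else v (b k i) j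
perm n k ε (v i j) = if oddSum i j then u (b k i) j else u (a k ε i) j

lam : (n k : ℕ) → V n → V n
lam n k = perm n k (+ 1)

tau : (n k : ℕ) → V n → V n
tau n k = perm n k (ℤ.- (+ 1))

-- Write n = 2m with m odd, and ε = 1 for λ, ε = -1 for τ, so that σ = perm n k ε.  As k is even
-- and m, ε are odd, k² ≡ ε (mod m) is equivalent to k² ≡ ε + m (mod n).  Under this congruence
-- the subscript of σ(u_{i,j}) is i k + e m modulo n with e ≡ i + j (mod 2), and that of σ(v_{i,j})
-- is i k + e m with e ≡ 1 + i + j.  A direct computation then shows that σ sends outer edges to
-- inner edges, inner edges to outer edges and spokes to spokes, and that σ² is the involution
-- i ↦ m + ε i on subscripts; hence σ⁴ = 1, so σ is bijective, reflects adjacency and lies in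
-- B(n,k).  Conversely, σ sends the inner edge (v_0,0)(v_k,1) to the pair (u_{ε-k²},0), (u_{k²},1),
-- which is an edge only if 2k² ≡ ε ± 1 (mod n), i.e. k² ≡ ε or k² ≡ 0 (mod m); the latter is
-- excluded because m is coprime to k and 0 < k < m.

module Submission where

open import Defs
open import Data.Bool using (Bool; true; false; not)
open import Data.Empty using (⊥-elim)
open import Data.Fin as Fin using (Fin; toℕ)
open import Data.Fin.Properties using (toℕ-fromℕ<; toℕ-injective; toℕ<n)
open import Data.Integer as ℤ using (ℤ; +_; -[1+_]; _+_; _*_; _-_; -_)
import Data.Integer.Properties as ℤ
open import Data.Integer.DivMod using (a≡a%ℕn+[a/ℕn]*n)
open import Data.Integer.Tactic.RingSolver using (solve)
open import Data.List using ([]; _∷_)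
open import Data.Nat as ℕ using (ℕ; zero; suc; _≤_; _<_; _∸_; _/_)
import Data.Nat.Properties as ℕ
open import Data.Nat.Coprimality using (Coprime; coprime-divisor)
open import Data.Nat.DivMod using (m≡m%n+[m/n]*n; [m+kn]%n≡m%n; m<n⇒m%n≡m; m%n<n; m*n/n≡m)
open import Data.Nat.Divisibility using (_∣_; divides; ∣-trans; ∣⇒≤; 0∣⇒≡0; m%n≡0⇒n∣m)
open import Data.Nat.GCD using (gcd; gcd-greatest)
open import Data.Product using (_×_; _,_; proj₁)
open import Data.Sum using (_⊎_; inj₁; inj₂; swap; [_,_]′)
open import Function.Base using (id; case_of_)
open import Function.Bundles using (_⇔_; mk⇔; Equivalence)
open import Function.Consequences.Propositional
  using (inverseᵇ⇒bijective; strictlyInverseˡ⇒inverseˡ; strictlyInverseʳ⇒inverseʳ)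
open import Function.Construct.Composition using (_⇔-∘_)
open import Function.Construct.Symmetry using (⇔-sym)
open import Function.Definitions using (Bijective)
open import Level using (0ℓ)
open import Relation.Binary.Bundles using (Setoid)
open import Relation.Binary.PropositionalEquality
open import Relation.Nullary using (¬_)

-- The modulus is an integer so that the ring solver can treat it as a variable.
infix 4 _≡_mod_
record _≡_mod_ (x y d : ℤ) : Set where
  constructor witness
  field
    quotient : ℤ
    equation : x ≡ y + quotient * d

module _ {d : ℤ} where

  mod-reflexive : ∀ {x y} → x ≡ y → x ≡ y mod d
  mod-reflexive {x} refl = witness (+ 0) (solve (x ∷ d ∷ []))

  mod-refl : ∀ {x} → x ≡ x mod d
  mod-refl = mod-reflexive refl

  mod-sym : ∀ {x y} → x ≡ y mod d → y ≡ x mod d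
  mod-sym (witness q eq) = witness (- q) (transpose q eq)
    where transpose : ∀ {x y} q → x ≡ y + q * d → y ≡ x + (- q) * d
          transpose {y = y} q refl = solve (y ∷ q ∷ d ∷ [])

  mod-trans : ∀ {x y z} → x ≡ y mod d → y ≡ z mod d → x ≡ z mod d
  mod-trans {z = z} (witness q refl) (witness r refl) = witness (r + q) (solve (z ∷ q ∷ r ∷ d ∷ []))

  +-cong-mod : ∀ {x y x′ y′} → x ≡ y mod d → x′ ≡ y′ mod d → x + x′ ≡ y + y′ mod d
  +-cong-mod {y = y} {y′ = y′} (witness q refl) (witness r refl) =
    witness (q + r) (solve (y ∷ y′ ∷ q ∷ r ∷ d ∷ []))

  *-cong-mod : ∀ {x y x′ y′} → x ≡ y mod d → x′ ≡ y′ mod d → x * x′ ≡ y * y′ mod d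
  *-cong-mod {y = y} {y′ = y′} (witness q refl) (witness r refl) =
    witness (y * r + q * y′ + q * r * d) (solve (y ∷ y′ ∷ q ∷ r ∷ d ∷ []))

  +-congˡ-mod : ∀ c {x y} → x ≡ y mod d → c + x ≡ c + y mod d
  +-congˡ-mod c = +-cong-mod (mod-refl {c})

  +-congʳ-mod : ∀ c {x y} → x ≡ y mod d → x + c ≡ y + c mod d
  +-congʳ-mod c x≡y = +-cong-mod x≡y (mod-refl {c})

  *-congˡ-mod : ∀ c {x y} → x ≡ y mod d → c * x ≡ c * y mod d
  *-congˡ-mod c = *-cong-mod (mod-refl {c})

  *-congʳ-mod : ∀ c {x y} → x ≡ y mod d → x * c ≡ y * c mod d
  *-congʳ-mod c x≡y = *-cong-mod x≡y (mod-refl {c})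

neg-cong-mod : ∀ {x y d} → x ≡ y mod d → - x ≡ - y mod d
neg-cong-mod {y = y} {d} (witness q refl) = witness (- q) (solve (y ∷ q ∷ d ∷ []))

mod-setoid : ℤ → Setoid 0ℓ 0ℓ
mod-setoid d = record
  { Carrier = ℤ
  ; _≈_ = λ x y → x ≡ y mod d
  ; isEquivalence = record { refl = mod-refl ; sym = mod-sym ; trans = mod-trans }
  }

module ≡-mod-Reasoning (d : ℤ) where
  open import Relation.Binary.Reasoning.Setoid (mod-setoid d) public

mod-*ʳ⇒mod : ∀ {x y} c e → x ≡ y mod (c * e) → x ≡ y mod c
mod-*ʳ⇒mod {y = y} c e (witness q refl) = witness (q * e) (solve (y ∷ q ∷ c ∷ e ∷ []))

*-mod-scale : ∀ {x y c} e → x ≡ y mod c → x * e ≡ y * e mod (c * e)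
*-mod-scale {y = y} {c} e (witness q refl) = witness q (solve (y ∷ q ∷ c ∷ e ∷ []))

*-mod-cancelˡ : ∀ {x y} c e .{{_ : ℤ.NonZero c}} → c * x ≡ c * y mod (c * e) → x ≡ y mod e
*-mod-cancelˡ {x} {y} c e (witness q eq) =
  witness q (ℤ.*-cancelˡ-≡ c x (y + q * e) (trans eq (solve (c ∷ y ∷ q ∷ e ∷ []))))

remainder-unique : ∀ {r s t d} → r ℕ.< d → s ℕ.< d → r ≡ s ℕ.+ t ℕ.* d → r ≡ s
remainder-unique {r} {s} {t} {d@(suc _)} r<d s<d r≡s+td = begin
  r                     ≡⟨ m<n⇒m%n≡m r<d ⟨
  r ℕ.% d               ≡⟨ cong (ℕ._% d) r≡s+td ⟩
  (s ℕ.+ t ℕ.* d) ℕ.% d ≡⟨ [m+kn]%n≡m%n s t d ⟩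
  s ℕ.% d               ≡⟨ m<n⇒m%n≡m s<d ⟩
  s                     ∎
  where open ≡-Reasoning

pos-+-*-injective : ∀ {r} s t d → + r ≡ + s + + t * + d → r ≡ s ℕ.+ t ℕ.* d
pos-+-*-injective s t d eq =
  ℤ.+-injective (trans eq (sym (trans (ℤ.pos-+ s (t ℕ.* d)) (cong (λ w → + s + w) (ℤ.pos-* t d)))))

mod-unique : ∀ {r s d} → r ℕ.< d → s ℕ.< d → + r ≡ + s mod + d → r ≡ s
mod-unique {r} {s} {d} r<d s<d (witness (+ t) eq) =
  remainder-unique {t = t} r<d s<d (pos-+-*-injective s t d eq)
mod-unique {r} {s} {d} r<d s<d r≡s@(witness -[1+ t ] _) =
  sym (remainder-unique {t = suc t} s<d r<d
        (pos-+-*-injective r (suc t) d (_≡_mod_.equation (mod-sym r≡s))))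

x+x≡0-mod-2 : ∀ x → x + x ≡ + 0 mod + 2
x+x≡0-mod-2 x = witness x (solve (x ∷ []))

-x≡x-mod-2 : ∀ x → - x ≡ x mod + 2
-x≡x-mod-2 x = witness (- x) (solve (x ∷ []))

1-x≡x+1-mod-2 : ∀ x → + 1 - x ≡ x + + 1 mod + 2
1-x≡x+1-mod-2 x = witness (- x) (solve (x ∷ []))

+-mod-shift : ∀ {d} x y c c′ {x′ y′ e e′} → x′ ≡ x + c mod d → y′ ≡ y + c′ mod d →
              x + y ≡ e mod d → x′ + y′ ≡ e′ mod d → e′ ≡ e + (c + c′) mod d
+-mod-shift {d} x y c c′ {x′} {y′} {e} {e′} x′≡ y′≡ x+y≡e x′+y′≡e′ = begin
  e′                   ≈⟨ x′+y′≡e′ ⟨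
  x′ + y′              ≈⟨ +-cong-mod x′≡ y′≡ ⟩
  x + c + (y + c′)     ≡⟨ solve (x ∷ y ∷ c ∷ c′ ∷ []) ⟩
  x + y + (c + c′)     ≈⟨ +-congʳ-mod (c + c′) x+y≡e ⟩
  e + (c + c′)         ∎
  where open ≡-mod-Reasoning d

complement-parity : ∀ {c e e′} → c ≡ + 0 mod + 2 → e′ ≡ e + (c + + 1) mod + 2 → + 1 - e′ ≡ e mod + 2
complement-parity {c} {e} {e′} c≡0 e′≡ = begin
  + 1 - e′                ≈⟨ +-congˡ-mod (+ 1) (neg-cong-mod e′≡) ⟩
  + 1 - (e + (c + + 1))   ≈⟨ +-congˡ-mod (+ 1) (neg-cong-mod (+-congˡ-mod e (+-congʳ-mod _ c≡0))) ⟩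
  + 1 - (e + (+ 0 + + 1)) ≡⟨ solve (e ∷ []) ⟩
  - e                     ≈⟨ -x≡x-mod-2 e ⟩
  e                       ∎
  where open ≡-mod-Reasoning (+ 2)

+-transpose-mod : ∀ {d y} x c → y ≡ x + c mod d → x ≡ y + - c mod d
+-transpose-mod {d} {y} x c y≡x+c = begin
  x              ≡⟨ solve (x ∷ c ∷ []) ⟩
  x + c + - c    ≈⟨ +-congʳ-mod (- c) y≡x+c ⟨
  y + - c        ∎
  where open ≡-mod-Reasoning d

+-≡0-mod⇔ : ∀ {x c d} → x + c ≡ + 0 mod d ⇔ x ≡ - c mod d
+-≡0-mod⇔ {x} {c} {d} = mk⇔ to from
  where
  open ≡-mod-Reasoning d
  to : x + c ≡ + 0 mod d → x ≡ - c mod d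
  to x+c≡0 = begin
    x           ≡⟨ solve (x ∷ c ∷ []) ⟩
    x + c - c   ≈⟨ +-cong-mod x+c≡0 mod-refl ⟩
    + 0 - c     ≡⟨ solve (c ∷ []) ⟩
    - c         ∎
  from : x ≡ - c mod d → x + c ≡ + 0 mod d
  from x≡-c = begin
    x + c       ≈⟨ +-cong-mod x≡-c mod-refl ⟩
    - c + c     ≡⟨ solve (c ∷ []) ⟩
    + 0         ∎

∣⇔≡0-mod : ∀ {d x} → d ∣ x ⇔ + x ≡ + 0 mod + d
∣⇔≡0-mod {d} {x} = mk⇔
  (λ { (divides q x≡qd) →
         witness (+ q) (trans (cong +_ x≡qd) (trans (ℤ.pos-* q d) (sym (ℤ.+-identityˡ (+ q * + d))))) })
  (λ { (witness q x≡qd) →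
         divides ℤ.∣ q ∣ (trans (cong ℤ.∣_∣ (trans x≡qd (ℤ.+-identityˡ (q * + d)))) (ℤ.abs-* q (+ d))) })

∣-∸1⇔ : ∀ {d x} → 1 ℕ.≤ x → d ∣ x ℕ.∸ 1 ⇔ + x ≡ + 1 mod + d
∣-∸1⇔ {d} {x} 1≤x =
  +-≡0-mod⇔ {c = - + 1} ⇔-∘ subst (λ z → d ∣ x ℕ.∸ 1 ⇔ z ≡ + 0 mod + d) x∸1≡x-1 ∣⇔≡0-mod
  where
  x∸1≡x-1 : + (x ℕ.∸ 1) ≡ + x + - + 1
  x∸1≡x-1 = sym (trans (ℤ.m-n≡m⊖n x 1) (ℤ.⊖-≥ 1≤x))

∣-+1⇔ : ∀ {d x} → d ∣ x ℕ.+ 1 ⇔ + x ≡ - + 1 mod + d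
∣-+1⇔ {d} {x} =
  +-≡0-mod⇔ {c = + 1} ⇔-∘ subst (λ z → d ∣ x ℕ.+ 1 ⇔ z ≡ + 0 mod + d) (ℤ.pos-+ x 1) ∣⇔≡0-mod

zi-ix : ∀ {n} (i : Fin (suc n)) z → zi (ix i z) ≡ z mod + suc n
zi-ix {n} i z = mod-sym (witness (z ℤ./ℕ suc n) (trans (a≡a%ℕn+[a/ℕn]*n z (suc n))
  (cong (λ r → + r + (z ℤ./ℕ suc n) * + suc n) (sym (toℕ-fromℕ< _)))))

zi-injective-mod : ∀ {n} {p q : Fin n} → zi p ≡ zi q mod + n → p ≡ q
zi-injective-mod {p = p} {q} p≡q = toℕ-injective (mod-unique (toℕ<n p) (toℕ<n q) p≡q)

ix-mod : ∀ {n} (i : Fin (suc n)) {z} {q : Fin (suc n)} → z ≡ zi q mod + suc n → ix i z ≡ q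
ix-mod i {z} z≡q = zi-injective-mod (mod-trans (zi-ix i z) z≡q)

bit : Bool → ℤ
bit false = + 0
bit true  = + 1

bit-injective : ∀ {b b′} → bit b ≡ bit b′ mod + 2 → b ≡ b′
bit-injective {false} {false} _ = refl
bit-injective {true}  {true}  _ = refl
bit-injective {false} {true}  0≡1 with () ← mod-unique {0} {1} (ℕ.s≤s ℕ.z≤n) (ℕ.s≤s (ℕ.s≤s ℕ.z≤n)) 0≡1
bit-injective {true}  {false} 1≡0 with () ← mod-unique {1} {0} (ℕ.s≤s (ℕ.s≤s ℕ.z≤n)) (ℕ.s≤s ℕ.z≤n) 1≡0

bit-not : ∀ b → bit (not b) ≡ + 1 - bit b
bit-not false = refl
bit-not true  = refl

n≡n%2-mod-2 : ∀ s → + s ≡ + (s ℕ.% 2) mod + 2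
n≡n%2-mod-2 s = witness (+ (s ℕ./ 2)) (trans (cong +_ (m≡m%n+[m/n]*n s 2))
  (trans (ℤ.pos-+ (s ℕ.% 2) _) (cong (λ w → + (s ℕ.% 2) + w) (ℤ.pos-* (s ℕ./ 2) 2))))

oddSum-spec : ∀ {n} (i : Fin n) j → zi i + zi j ≡ bit (oddSum i j) mod + 2
oddSum-spec i j
  with (toℕ i ℕ.+ toℕ j) ℕ.% 2 | n≡n%2-mod-2 (toℕ i ℕ.+ toℕ j) | m%n<n (toℕ i ℕ.+ toℕ j) 2
... | zero        | s≡0 | _ = mod-trans (mod-reflexive (sym (ℤ.pos-+ (toℕ i) (toℕ j)))) s≡0
... | suc zero    | s≡1 | _ = mod-trans (mod-reflexive (sym (ℤ.pos-+ (toℕ i) (toℕ j)))) s≡1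
... | suc (suc _) | _   | ℕ.s≤s (ℕ.s≤s ())

oddSum-≡ : ∀ {n} (i : Fin n) j {b} → zi i + zi j ≡ bit b mod + 2 → oddSum i j ≡ b
oddSum-≡ i j ij≡b = bit-injective (mod-trans (mod-sym (oddSum-spec i j)) ij≡b)

data Sign : ℤ → Set where
  plus  : Sign (+ 1)
  minus : Sign (- + 1)

sign-odd : ∀ {ε} → Sign ε → ε ≡ + 1 mod + 2
sign-odd plus  = mod-refl
sign-odd minus = witness (- + 1) refl

sign-suc-even : ∀ {ε} → Sign ε → + 1 + ε ≡ + 0 mod + 2
sign-suc-even plus  = witness (+ 1) refl
sign-suc-even minus = mod-refl

sign-square : ∀ {ε} → Sign ε → ε * ε ≡ + 1
sign-square plus  = refl
sign-square minus = refl

module Modulus {N M : ℤ} (N≡2M : N ≡ + 2 * M) where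

  mod-N⇒mod-2 : ∀ {x y} → x ≡ y mod N → x ≡ y mod + 2
  mod-N⇒mod-2 {x} {y} x≡y = mod-*ʳ⇒mod (+ 2) M (subst (λ d → x ≡ y mod d) N≡2M x≡y)

  *M-mod-N : ∀ {x y} → x ≡ y mod + 2 → x * M ≡ y * M mod N
  *M-mod-N {x} {y} x≡y = subst (λ d → x * M ≡ y * M mod d) (sym N≡2M) (*-mod-scale M x≡y)

  halve-mod : ∀ {x} y → + 2 * x ≡ + 2 * y mod N → x ≡ y mod M
  halve-mod {x} y 2x≡2y = *-mod-cancelˡ (+ 2) M (subst (λ d → + 2 * x ≡ + 2 * y mod d) N≡2M 2x≡2y)

  halve-mod-sign : ∀ {x ε} → Sign ε → + 2 * x ≡ ε + + 1 mod N ⊎ + 2 * x ≡ ε - + 1 mod N →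
                   x ≡ ε mod M ⊎ x ≡ + 0 mod M
  halve-mod-sign plus  (inj₁ 2x≡2) = inj₁ (halve-mod (+ 1) 2x≡2)
  halve-mod-sign plus  (inj₂ 2x≡0) = inj₂ (halve-mod (+ 0) 2x≡0)
  halve-mod-sign minus (inj₁ 2x≡0) = inj₂ (halve-mod (+ 0) 2x≡0)
  halve-mod-sign minus (inj₂ 2x≡-2) = inj₁ (halve-mod (- + 1) 2x≡-2)

  adjacent-subscripts⇒square : ∀ {ε} → Sign ε → ∀ K {A B} →
    A ≡ ε + (+ 0 - K) * K mod N → B ≡ K * K mod N → B ≡ A + + 1 mod N ⊎ A ≡ B + + 1 mod N →
    K * K ≡ ε mod M ⊎ K * K ≡ + 0 mod M
  adjacent-subscripts⇒square {ε} ε-sign K {A} {B} A≡ B≡ B≡A±1 =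
    halve-mod-sign ε-sign (twice-square B≡A±1)
    where
    open ≡-mod-Reasoning N
    twice-square : B ≡ A + + 1 mod N ⊎ A ≡ B + + 1 mod N →
      + 2 * (K * K) ≡ ε + + 1 mod N ⊎ + 2 * (K * K) ≡ ε - + 1 mod N
    twice-square (inj₁ B≡A+1) = inj₁ (begin
      + 2 * (K * K)                      ≡⟨ solve (K ∷ []) ⟩
      K * K + K * K                      ≈⟨ +-congʳ-mod (K * K) B≡ ⟨
      B + K * K                          ≈⟨ +-congʳ-mod (K * K) B≡A+1 ⟩
      A + + 1 + K * K                    ≈⟨ +-congʳ-mod (K * K) (+-congʳ-mod (+ 1) A≡) ⟩
      ε + (+ 0 - K) * K + + 1 + K * K    ≡⟨ solve (ε ∷ K ∷ []) ⟩
      ε + + 1                            ∎)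
    twice-square (inj₂ A≡B+1) = inj₂ (begin
      + 2 * (K * K)                      ≡⟨ solve (K ∷ []) ⟩
      K * K + + 1 + K * K - + 1          ≈⟨ +-congʳ-mod _ (+-congʳ-mod (K * K) (+-congʳ-mod _ B≡)) ⟨
      B + + 1 + K * K - + 1              ≈⟨ +-congʳ-mod (- + 1) (+-congʳ-mod (K * K) A≡B+1) ⟨
      A + K * K - + 1                    ≈⟨ +-congʳ-mod (- + 1) (+-congʳ-mod (K * K) A≡) ⟩
      ε + (+ 0 - K) * K + K * K - + 1    ≡⟨ solve (ε ∷ K ∷ []) ⟩
      ε - + 1                            ∎)

module Arithmetic {N K M ε : ℤ} (N≡2M : N ≡ + 2 * M) (K-even : K ≡ + 0 mod + 2)
                  (M-odd : M ≡ + 1 mod + 2) (ε-sign : Sign ε) where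

  open Modulus N≡2M public

  square-quotient-odd : ∀ q → K * K ≡ ε + q * M → q ≡ + 1 mod + 2
  square-quotient-odd q K²≡ε+qM = begin
    q                 ≡⟨ solve (q ∷ []) ⟩
    q * + 1           ≈⟨ *-congˡ-mod q M-odd ⟨
    q * M             ≡⟨ solve (ε ∷ q ∷ M ∷ []) ⟩
    ε + q * M - ε     ≡⟨ cong (_- ε) K²≡ε+qM ⟨
    K * K - ε         ≈⟨ +-cong-mod (*-cong-mod K-even K-even) (neg-cong-mod (sign-odd ε-sign)) ⟩
    - + 1             ≈⟨ witness (- + 1) refl ⟩
    + 1               ∎
    where open ≡-mod-Reasoning (+ 2)

  square-mod-N : K * K ≡ ε mod M → K * K ≡ ε + M mod N
  square-mod-N (witness q K²≡ε+qM) = begin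
    K * K       ≡⟨ K²≡ε+qM ⟩
    ε + q * M   ≈⟨ +-congˡ-mod ε (*M-mod-N (square-quotient-odd q K²≡ε+qM)) ⟩
    ε + + 1 * M ≡⟨ solve (ε ∷ M ∷ []) ⟩
    ε + M       ∎
    where open ≡-mod-Reasoning N

  M+M≡0 : M + M ≡ + 0 mod N
  M+M≡0 = begin
    M + M             ≡⟨ solve (M ∷ []) ⟩
    (+ 1 + + 1) * M   ≈⟨ *M-mod-N (x+x≡0-mod-2 (+ 1)) ⟩
    + 0               ∎
    where open ≡-mod-Reasoning N

  M+εM≡0 : M + ε * M ≡ + 0 mod N
  M+εM≡0 = begin
    M + ε * M     ≡⟨ solve (M ∷ ε ∷ []) ⟩
    (+ 1 + ε) * M ≈⟨ *M-mod-N (sign-suc-even ε-sign) ⟩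
    + 0           ∎
    where open ≡-mod-Reasoning N

  half-turn-mod-involutive : ∀ {I I′} → I′ ≡ M + ε * I mod N → M + ε * I′ ≡ I mod N
  half-turn-mod-involutive {I} {I′} I′≡ = begin
    M + ε * I′                 ≈⟨ +-congˡ-mod M (*-congˡ-mod ε I′≡) ⟩
    M + ε * (M + ε * I)        ≡⟨ solve (M ∷ ε ∷ I ∷ []) ⟩
    (M + ε * M) + (ε * ε) * I  ≈⟨ +-congʳ-mod _ M+εM≡0 ⟩
    + 0 + (ε * ε) * I          ≡⟨ cong (λ e → + 0 + e * I) (sign-square ε-sign) ⟩
    + 0 + + 1 * I              ≡⟨ solve (I ∷ []) ⟩
    I                          ∎
    where open ≡-mod-Reasoning N

  -- The subscript of σ(u_{i,j}) is congruent to form e i modulo n, where e ≡ i + j (mod 2), and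
  -- that of σ(v_{i,j}) to form e i with e ≡ 1 - (i + j).  Integer arguments that occur under _+_
  -- are explicit below: at the use sites they are subscripts zi i, on which _+_ computes.
  module Forms (K²≡ε+M : K * K ≡ ε + M mod N) where

    form : ℤ → ℤ → ℤ
    form e I = I * K + e * M

    form-parity : ∀ e I → form e I ≡ e mod + 2
    form-parity e I = begin
      I * K + e * M       ≈⟨ +-cong-mod (*-congˡ-mod I K-even) (*-congˡ-mod e M-odd) ⟩
      I * + 0 + e * + 1   ≡⟨ solve (I ∷ e ∷ []) ⟩
      e                   ∎
      where open ≡-mod-Reasoning (+ 2)

    form-cong : ∀ {e e′ I I′} → I′ ≡ I mod N → e′ ≡ e mod + 2 → form e′ I′ ≡ form e I mod N
    form-cong I′≡I e′≡e = +-cong-mod (*-congʳ-mod K I′≡I) (*M-mod-N e′≡e)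

    a-subscript : ∀ I → ε + (I - K) * K ≡ form (+ 1) I mod N
    a-subscript I = begin
      ε + (I - K) * K         ≡⟨ solve (ε ∷ I ∷ K ∷ []) ⟩
      ε + I * K - K * K       ≈⟨ +-congˡ-mod (ε + I * K) (neg-cong-mod K²≡ε+M) ⟩
      ε + I * K - (ε + M)     ≡⟨ solve (ε ∷ I ∷ K ∷ M ∷ []) ⟩
      I * K + M - (M + M)     ≈⟨ +-congˡ-mod (I * K + M) (neg-cong-mod M+M≡0) ⟩
      I * K + M - + 0         ≡⟨ solve (I ∷ K ∷ M ∷ []) ⟩
      I * K + + 1 * M         ∎
      where open ≡-mod-Reasoning N

    b-subscript : ∀ I → I * K ≡ form (+ 0) I mod N
    b-subscript I = mod-reflexive (sym (ℤ.+-identityʳ (I * K)))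

    form-twice : ∀ {e e′ I P} → P ≡ form e I mod N → I + e′ ≡ + 1 mod + 2 →
                 form e′ P ≡ M + ε * I mod N
    form-twice {e} {e′} {I} {P} P≡ I+e′≡1 = begin
      P * K + e′ * M                      ≈⟨ +-congʳ-mod (e′ * M) (*-congʳ-mod K P≡) ⟩
      (I * K + e * M) * K + e′ * M        ≡⟨ solve (I ∷ K ∷ e ∷ M ∷ e′ ∷ []) ⟩
      I * (K * K) + e * (K * M) + e′ * M  ≈⟨ +-congʳ-mod (e′ * M) (+-cong-mod
                                               (*-congˡ-mod I K²≡ε+M) (*-congˡ-mod e (*M-mod-N K-even))) ⟩
      I * (ε + M) + e * + 0 + e′ * M      ≡⟨ solve (I ∷ ε ∷ M ∷ e ∷ e′ ∷ []) ⟩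
      ε * I + (I + e′) * M                ≈⟨ +-congˡ-mod (ε * I) (*M-mod-N I+e′≡1) ⟩
      ε * I + + 1 * M                     ≡⟨ solve (ε ∷ I ∷ M ∷ []) ⟩
      M + ε * I                           ∎
      where open ≡-mod-Reasoning N

    σ²-form-u : ∀ I J P {e e′} → I + J ≡ e mod + 2 → P ≡ form e I mod N →
                P + J ≡ e′ mod + 2 → form (+ 1 - e′) P ≡ M + ε * I mod N
    σ²-form-u I J P {e} {e′} I+J≡e P≡ P+J≡e′ = form-twice {e = e} P≡ (begin
      I + (+ 1 - e′)              ≈⟨ +-congˡ-mod I (+-congˡ-mod (+ 1) (neg-cong-mod P+J≡e′)) ⟨
      I + (+ 1 - (P + J))         ≈⟨ +-congˡ-mod I (+-congˡ-mod (+ 1) (neg-cong-mod (+-congʳ-mod J P≡e))) ⟩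
      I + (+ 1 - (e + J))         ≈⟨ +-congˡ-mod I (+-congˡ-mod (+ 1) (neg-cong-mod (+-congʳ-mod J I+J≡e))) ⟨
      I + (+ 1 - (I + J + J))     ≡⟨ solve (I ∷ J ∷ []) ⟩
      + 1 - (J + J)               ≈⟨ +-congˡ-mod (+ 1) (neg-cong-mod (x+x≡0-mod-2 J)) ⟩
      + 1                         ∎)
      where
      open ≡-mod-Reasoning (+ 2)
      P≡e : P ≡ e mod + 2
      P≡e = mod-trans (mod-N⇒mod-2 P≡) (form-parity e I)

    σ²-form-v : ∀ I J P {e e′} → I + J ≡ e mod + 2 → P ≡ form (+ 1 - e) I mod N →
                P + J ≡ e′ mod + 2 → form e′ P ≡ M + ε * I mod N
    σ²-form-v I J P {e} {e′} I+J≡e P≡ P+J≡e′ = form-twice {e = + 1 - e} P≡ (begin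
      I + e′                      ≈⟨ +-congˡ-mod I P+J≡e′ ⟨
      I + (P + J)                 ≈⟨ +-congˡ-mod I (+-congʳ-mod J P≡1-e) ⟩
      I + (+ 1 - e + J)           ≈⟨ +-congˡ-mod I (+-congʳ-mod J (+-congˡ-mod (+ 1) (neg-cong-mod I+J≡e))) ⟨
      I + (+ 1 - (I + J) + J)     ≡⟨ solve (I ∷ J ∷ []) ⟩
      + 1                         ∎)
      where
      open ≡-mod-Reasoning (+ 2)
      P≡1-e : P ≡ + 1 - e mod + 2
      P≡1-e = mod-trans (mod-N⇒mod-2 P≡) (form-parity (+ 1 - e) I)

    σ-outer-form : ∀ I J I′ J′ {e e′} → I′ ≡ I + + 1 mod N → J′ ≡ J + + 1 mod + 2 →
                   I + J ≡ e mod + 2 → I′ + J′ ≡ e′ mod + 2 → form e′ I′ ≡ form e I + K mod N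
    σ-outer-form I J I′ J′ {e} {e′} I′≡ J′≡ I+J≡e I′+J′≡e′ = begin
      form e′ I′             ≈⟨ form-cong I′≡ e′≡e ⟩
      (I + + 1) * K + e * M  ≡⟨ solve (I ∷ K ∷ e ∷ M ∷ []) ⟩
      I * K + e * M + K      ∎
      where
      open ≡-mod-Reasoning N
      e′≡e : e′ ≡ e mod + 2
      e′≡e = mod-trans (+-mod-shift I J (+ 1) (+ 1) (mod-N⇒mod-2 I′≡) J′≡ I+J≡e I′+J′≡e′)
                       (witness (+ 1) refl)

    σ-spoke-form : ∀ I J J′ {e e′} → J′ ≡ J + + 1 mod + 2 → I + J ≡ e mod + 2 →
                   I + J′ ≡ e′ mod + 2 → form (+ 1 - e′) I ≡ form e I mod N
    σ-spoke-form I J J′ {e} J′≡ I+J≡e I+J′≡e′ =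
      form-cong (mod-refl {x = I}) (complement-parity {e = e} mod-refl
        (+-mod-shift I J (+ 0) (+ 1) (mod-reflexive (sym (ℤ.+-identityʳ I))) J′≡ I+J≡e I+J′≡e′))

    σ-inner-form : ∀ I J I′ J′ {e e′} → I′ ≡ I + K mod N → J′ ≡ J + + 1 mod + 2 →
                   I + J ≡ e mod + 2 → I′ + J′ ≡ e′ mod + 2 →
                   form (+ 1 - e′) I′ ≡ form (+ 1 - e) I + ε mod N
    σ-inner-form I J I′ J′ {e} {e′} I′≡ J′≡ I+J≡e I′+J′≡e′ = begin
      form (+ 1 - e′) I′          ≈⟨ form-cong I′≡ 1-e′≡e ⟩
      (I + K) * K + e * M         ≡⟨ solve (I ∷ K ∷ e ∷ M ∷ []) ⟩
      I * K + e * M + K * K       ≈⟨ +-congˡ-mod (I * K + e * M) K²≡ε+M ⟩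
      I * K + e * M + (ε + M)     ≡⟨ solve (I ∷ K ∷ e ∷ M ∷ ε ∷ []) ⟩
      I * K + (e + + 1) * M + ε   ≈⟨ +-congʳ-mod ε (+-congˡ-mod (I * K) (*M-mod-N (1-x≡x+1-mod-2 e))) ⟨
      I * K + (+ 1 - e) * M + ε   ∎
      where
      open ≡-mod-Reasoning N
      1-e′≡e : + 1 - e′ ≡ e mod + 2
      1-e′≡e = complement-parity K-even
                 (+-mod-shift I J K (+ 1) (mod-N⇒mod-2 I′≡) J′≡ I+J≡e I′+J′≡e′)

module _ {A : Set} (f : A → A) (f⁴≡id : ∀ x → f (f (f (f x))) ≡ x) where

  order-4⇒bijective : Bijective _≡_ _≡_ f
  order-4⇒bijective = inverseᵇ⇒bijective
    (strictlyInverseˡ⇒inverseˡ f f⁴≡id , strictlyInverseʳ⇒inverseʳ f f⁴≡id)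

  order-4-preserves⇒⇔ : (R : A → A → Set) → (∀ x y → R x y → R (f x) (f y)) →
                        ∀ x y → R x y ⇔ R (f x) (f y)
  order-4-preserves⇒⇔ R pres x y =
    mk⇔ (pres x y) (λ r → subst₂ R (f⁴≡id x) (f⁴≡id y) (pres _ _ (pres _ _ (pres _ _ r))))

symmetric-closure-preserved : ∀ {A : Set} {R : A → A → Set} (f : A → A) →
  (∀ {x y} → R x y → R (f x) (f y) ⊎ R (f y) (f x)) →
  ∀ x y → R x y ⊎ R y x → R (f x) (f y) ⊎ R (f y) (f x)
symmetric-closure-preserved f pres x y (inj₁ r) = pres r
symmetric-closure-preserved f pres x y (inj₂ r) = swap (pres r)

flip-parity : ∀ j → zi (flip j) ≡ zi j + + 1 mod + 2
flip-parity Fin.zero = mod-refl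
flip-parity (Fin.suc Fin.zero) = witness (- + 1) refl

flip-involutive : ∀ j → flip (flip j) ≡ j
flip-involutive Fin.zero = refl
flip-involutive (Fin.suc Fin.zero) = refl

spoke-flipped : ∀ {n k} (p : Fin n) j → E n k (u p (flip j)) (v p j)
spoke-flipped {n} {k} p j =
  subst (λ j′ → E n k (u p (flip j)) (v p j′)) (flip-involutive j) (spoke p (flip j))

sp-flipped : ∀ {n} (p : Fin n) j → SpokeGen n (u p (flip j)) (v p j)
sp-flipped {n} p j =
  subst (λ j′ → SpokeGen n (u p (flip j)) (v p j′)) (flip-involutive j) (sp p (flip j))

module Graph (n₀ k m : ℕ) (n≡2m : + suc n₀ ≡ + 2 * + m) (k-even : + k ≡ + 0 mod + 2)
             {ε : ℤ} (ε-sign : Sign ε) where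

  n : ℕ
  n = suc n₀

  K M : ℤ
  K = + k
  M = + m

  open Modulus {M = M} n≡2m

  σ : V n → V n
  σ = perm n k ε

  subscript : Bool → Fin n → Fin n
  subscript true  = a k ε
  subscript false = b k

  σ-u : ∀ i j → σ (u i j) ≡ v (subscript (oddSum i j) i) j
  σ-u i j with oddSum i j
  ... | true  = refl
  ... | false = refl

  σ-v : ∀ i j → σ (v i j) ≡ u (subscript (not (oddSum i j)) i) j
  σ-v i j with oddSum i j
  ... | true  = refl
  ... | false = refl

  outer-adj : ∀ {δ} → Sign δ → ∀ {p q} j → zi q ≡ zi p + δ mod + n → Adj n k (u p j) (u q (flip j))
  outer-adj plus {p} j q≡p+1 =
    subst (λ q → Adj n k (u p j) (u q (flip j))) (ix-mod p (mod-sym q≡p+1)) (inj₁ (outer p j))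
  outer-adj minus {p} {q} j q≡p-1 =
    subst₂ (λ p j′ → Adj n k (u p j′) (u q (flip j)))
           (ix-mod q (mod-sym (+-transpose-mod (zi p) (- + 1) q≡p-1))) (flip-involutive j)
           (inj₂ (outer q (flip j)))

  inner-adj : ∀ {p q} j → zi q ≡ zi p + K mod + n → Adj n k (v p j) (v q (flip j))
  inner-adj {p} j q≡p+K =
    subst (λ q → Adj n k (v p j) (v q (flip j))) (ix-mod p (mod-sym q≡p+K)) (inj₁ (inner p j))

  u-adjacent : ∀ {p q j j′} → Adj n k (u p j) (u q j′) →
               zi q ≡ zi p + + 1 mod + n ⊎ zi p ≡ zi q + + 1 mod + n
  u-adjacent {p}     (inj₁ (outer _ _)) = inj₁ (zi-ix p _)
  u-adjacent {q = q} (inj₂ (outer _ _)) = inj₂ (zi-ix q _)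

  necessity : InA n k σ → K * K ≡ ε mod M ⊎ K * K ≡ + 0 mod M
  necessity (_ , adj) =
    adjacent-subscripts⇒square ε-sign K {zi (a k ε Fin.zero)} {zi (b k y)}
      (zi-ix Fin.zero _) (mod-trans (zi-ix y _) (*-congʳ-mod K (zi-ix Fin.zero K)))
      (u-adjacent images-adjacent)
    where
    y : Fin n
    y = shift Fin.zero K
    y-odd : oddSum y (Fin.suc Fin.zero) ≡ true
    y-odd = oddSum-≡ y _ (+-congʳ-mod (+ 1) (mod-trans (mod-N⇒mod-2 (zi-ix Fin.zero K)) k-even))
    images-adjacent : Adj n k (u (a k ε Fin.zero) Fin.zero) (u (b k y) (Fin.suc Fin.zero))
    images-adjacent =
      subst (Adj n k _) (trans (σ-v y _) (cong (λ s → u (subscript (not s) y) _) y-odd))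
            (Equivalence.to (adj (v Fin.zero Fin.zero) (v y (Fin.suc Fin.zero)))
                            (inj₁ (inner Fin.zero Fin.zero)))

  module Sufficiency (m-odd : M ≡ + 1 mod + 2) (K²≡ε : K * K ≡ ε mod M) where

    open Arithmetic {K = K} {M = M} n≡2m k-even m-odd ε-sign
    open Forms (square-mod-N K²≡ε)

    zi-subscript : ∀ s i → zi (subscript s i) ≡ form (bit s) (zi i) mod + n
    zi-subscript true  i = mod-trans (zi-ix i _) (a-subscript (zi i))
    zi-subscript false i = mod-trans (zi-ix i _) (b-subscript (zi i))

    zi-subscript-not : ∀ s i → zi (subscript (not s) i) ≡ form (+ 1 - bit s) (zi i) mod + n
    zi-subscript-not s i =
      subst (λ e → zi (subscript (not s) i) ≡ form e (zi i) mod + n) (bit-not s) (zi-subscript (not s) i)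

    half-turn : Fin n → Fin n
    half-turn i = ix i (M + ε * zi i)

    ρ : V n → V n
    ρ (u i j) = u (half-turn i) j
    ρ (v i j) = v (half-turn i) j

    σ∘σ≡ρ : ∀ x → σ (σ x) ≡ ρ x
    σ∘σ≡ρ (u i j) = begin
      σ (σ (u i j))                          ≡⟨ cong σ (σ-u i j) ⟩
      σ (v P j)                              ≡⟨ σ-v P j ⟩
      u (subscript (not (oddSum P j)) P) j   ≡⟨ cong (λ p → u p j) (zi-injective-mod turn) ⟩
      u (half-turn i) j                      ∎
      where
      open ≡-Reasoning
      P = subscript (oddSum i j) i
      turn : zi (subscript (not (oddSum P j)) P) ≡ zi (half-turn i) mod + n
      turn = mod-trans (zi-subscript-not (oddSum P j) P)
        (mod-trans (σ²-form-u (zi i) (zi j) (zi P) (oddSum-spec i j) (zi-subscript (oddSum i j) i) (oddSum-spec P j))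
                   (mod-sym (zi-ix i _)))
    σ∘σ≡ρ (v i j) = begin
      σ (σ (v i j))                          ≡⟨ cong σ (σ-v i j) ⟩
      σ (u P j)                              ≡⟨ σ-u P j ⟩
      v (subscript (oddSum P j) P) j         ≡⟨ cong (λ p → v p j) (zi-injective-mod turn) ⟩
      v (half-turn i) j                      ∎
      where
      open ≡-Reasoning
      P = subscript (not (oddSum i j)) i
      turn : zi (subscript (oddSum P j) P) ≡ zi (half-turn i) mod + n
      turn = mod-trans (zi-subscript (oddSum P j) P)
        (mod-trans (σ²-form-v (zi i) (zi j) (zi P) (oddSum-spec i j) (zi-subscript-not (oddSum i j) i)
                              (oddSum-spec P j))
                   (mod-sym (zi-ix i _)))

    half-turn-involutive : ∀ i → half-turn (half-turn i) ≡ i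
    half-turn-involutive i =
      zi-injective-mod (mod-trans (zi-ix (half-turn i) _) (half-turn-mod-involutive (zi-ix i _)))

    ρ-involutive : ∀ x → ρ (ρ x) ≡ x
    ρ-involutive (u i j) = cong (λ p → u p j) (half-turn-involutive i)
    ρ-involutive (v i j) = cong (λ p → v p j) (half-turn-involutive i)

    σ⁴≡id : ∀ x → σ (σ (σ (σ x))) ≡ x
    σ⁴≡id x = trans (σ∘σ≡ρ (σ (σ x))) (trans (cong ρ (σ∘σ≡ρ x)) (ρ-involutive x))

    σ-v-flip : ∀ i j → σ (v i (flip j)) ≡ u (subscript (oddSum i j) i) (flip j)
    σ-v-flip i j = trans (σ-v i (flip j)) (cong (λ p → u p (flip j)) (zi-injective-mod same-subscript))
      where
      same-subscript : zi (subscript (not (oddSum i (flip j))) i)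
                       ≡ zi (subscript (oddSum i j) i) mod + n
      same-subscript = mod-trans (zi-subscript-not (oddSum i (flip j)) i)
        (mod-trans (σ-spoke-form (zi i) (zi j) (zi (flip j))
                                 (flip-parity j) (oddSum-spec i j) (oddSum-spec i (flip j)))
                   (mod-sym (zi-subscript (oddSum i j) i)))

    σ-edge : ∀ {x y} → E n k x y → Adj n k (σ x) (σ y)
    σ-edge (outer i j) =
      subst₂ (Adj n k) (sym (σ-u i j)) (sym (σ-u i′ (flip j))) (inner-adj j step)
      where
      i′ = shift i (+ 1)
      step : zi (subscript (oddSum i′ (flip j)) i′) ≡ zi (subscript (oddSum i j) i) + K mod + n
      step = mod-trans (zi-subscript (oddSum i′ (flip j)) i′)
        (mod-trans (σ-outer-form (zi i) (zi j) (zi i′) (zi (flip j))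
                                 (zi-ix i _) (flip-parity j) (oddSum-spec i j) (oddSum-spec i′ (flip j)))
                   (+-congʳ-mod K (mod-sym (zi-subscript (oddSum i j) i))))
    σ-edge (spoke i j) = subst₂ (Adj n k) (sym (σ-u i j)) (sym (σ-v-flip i j))
      (inj₂ (spoke-flipped (subscript (oddSum i j) i) j))
    σ-edge (inner i j) =
      subst₂ (Adj n k) (sym (σ-v i j)) (sym (σ-v i′ (flip j))) (outer-adj ε-sign j step)
      where
      i′ = shift i K
      step : zi (subscript (not (oddSum i′ (flip j))) i′)
             ≡ zi (subscript (not (oddSum i j)) i) + ε mod + n
      step = mod-trans (zi-subscript-not (oddSum i′ (flip j)) i′)
        (mod-trans (σ-inner-form (zi i) (zi j) (zi i′) (zi (flip j))
                                 (zi-ix i _) (flip-parity j) (oddSum-spec i j) (oddSum-spec i′ (flip j)))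
                   (+-congʳ-mod ε (mod-sym (zi-subscript-not (oddSum i j) i))))

    σ-spoke : ∀ {x y} → SpokeGen n x y → Spoke n (σ x) (σ y)
    σ-spoke (sp i j) = subst₂ (Spoke n) (sym (σ-u i j)) (sym (σ-v-flip i j))
      (inj₂ (sp-flipped (subscript (oddSum i j) i) j))

    σ∈B : InB n k σ
    σ∈B = ( order-4⇒bijective σ σ⁴≡id
          , order-4-preserves⇒⇔ σ σ⁴≡id (Adj n k) (symmetric-closure-preserved σ σ-edge))
        , order-4-preserves⇒⇔ σ σ⁴≡id (Spoke n) (symmetric-closure-preserved σ σ-spoke)

  automorphism⇔square : M ≡ + 1 mod + 2 → ¬ (K * K ≡ + 0 mod M) → InA n k σ ⇔ K * K ≡ ε mod M
  automorphism⇔square m-odd k²≢0 = mk⇔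
    (λ σ∈A → [ id , (λ k²≡0 → ⊥-elim (k²≢0 k²≡0)) ]′ (necessity σ∈A))
    (λ k²≡ε → proj₁ (Sufficiency.σ∈B m-odd k²≡ε))

  automorphism⇒stabiliser : M ≡ + 1 mod + 2 → ¬ (K * K ≡ + 0 mod M) → InA n k σ → InB n k σ
  automorphism⇒stabiliser m-odd k²≢0 σ∈A =
    Sufficiency.σ∈B m-odd (Equivalence.to (automorphism⇔square m-odd k²≢0) σ∈A)

2∣half⇒4∣ : ∀ {n m} → n ≡ m ℕ.* 2 → 2 ∣ m → 4 ∣ n
2∣half⇒4∣ n≡m*2 (divides t m≡t*2) =
  divides t (trans n≡m*2 (trans (cong (ℕ._* 2) m≡t*2) (ℕ.*-assoc t 2 2)))

odd⇒≡1-mod-2 : ∀ {m} → ¬ 2 ∣ m → + m ≡ + 1 mod + 2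
odd⇒≡1-mod-2 {m} 2∤m with m ℕ.% 2 in m%2≡ | n≡n%2-mod-2 m | m%n<n m 2
... | zero        | _   | _ = ⊥-elim (2∤m (m%n≡0⇒n∣m m 2 m%2≡))
... | suc zero    | m≡1 | _ = m≡1
... | suc (suc _) | _   | ℕ.s≤s (ℕ.s≤s ())

coprime-to-half : ∀ {n m k} → n ≡ m ℕ.* 2 → gcd n k ≡ 2 → ¬ 2 ∣ m → Coprime m k
coprime-to-half {m = m} n≡m*2 gcd≡2 2∤m {d} (d∣m , d∣k) =
  divisor-of-2 (subst (d ∣_) gcd≡2 (gcd-greatest (∣-trans d∣m m∣n) d∣k)) d∣m
  where
  m∣n : m ∣ _
  m∣n = divides 2 (trans n≡m*2 (ℕ.*-comm m 2))
  divisor-of-2 : ∀ {d} → d ∣ 2 → d ∣ m → d ≡ 1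
  divisor-of-2 {zero}              d∣2 _   = case 0∣⇒≡0 d∣2 of λ ()
  divisor-of-2 {suc zero}          _   _   = refl
  divisor-of-2 {suc (suc zero)}    _   2∣m = ⊥-elim (2∤m 2∣m)
  divisor-of-2 {suc (suc (suc _))} d∣2 _   with ∣⇒≤ d∣2
  ... | ℕ.s≤s (ℕ.s≤s ())

coprime⇒∤square : ∀ {m k} → Coprime m k → 1 ℕ.≤ k → k ℕ.< m → ¬ m ∣ k ℕ.* k
coprime⇒∤square cop (ℕ.s≤s ℕ.z≤n) k<m m∣k² = ℕ.<⇒≱ k<m (∣⇒≤ (coprime-divisor cop m∣k²))

lemma5p3 : (n k : ℕ) → 2 ∣ n → 2 ∣ k → 1 ≤ k → k < n / 2 → gcd n k ≡ 2 → ¬ (4 ∣ n) →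
    (InA n k (lam n k) ⇔ (n / 2) ∣ (k ℕ.* k ∸ 1))
    × (InA n k (tau n k) ⇔ (n / 2) ∣ (k ℕ.* k ℕ.+ 1))
    × (InA n k (lam n k) → InB n k (lam n k))
    × (InA n k (tau n k) → InB n k (tau n k))
lemma5p3 zero k _ _ _ () _ _
lemma5p3 (suc n₀) k (divides m n≡m*2) 2∣k 1≤k k<n/2 gcd≡2 4∤n
  rewrite trans (cong (_/ 2) n≡m*2) (m*n/n≡m m 2) =
    via-square (Λ.automorphism⇔square m-odd k²≢0) (∣-∸1⇔ (ℕ.*-mono-≤ 1≤k 1≤k))
  , via-square (T.automorphism⇔square m-odd k²≢0) ∣-+1⇔
  , Λ.automorphism⇒stabiliser m-odd k²≢0
  , T.automorphism⇒stabiliser m-odd k²≢0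
  where
  2∤m : ¬ 2 ∣ m
  2∤m 2∣m = 4∤n (2∣half⇒4∣ n≡m*2 2∣m)

  m-odd : + m ≡ + 1 mod + 2
  m-odd = odd⇒≡1-mod-2 2∤m

  k²≢0 : ¬ (+ k * + k ≡ + 0 mod + m)
  k²≢0 k²≡0 = coprime⇒∤square (coprime-to-half n≡m*2 gcd≡2 2∤m) 1≤k k<n/2
    (Equivalence.from ∣⇔≡0-mod (subst (λ X → X ≡ + 0 mod + m) (sym (ℤ.pos-* k k)) k²≡0))

  via-square : ∀ {A B c} → A ⇔ + k * + k ≡ c mod + m → B ⇔ + (k ℕ.* k) ≡ c mod + m → A ⇔ B
  via-square {c = c} A⇔ B⇔ =
    ⇔-sym B⇔ ⇔-∘ subst (λ X → _ ⇔ X ≡ c mod + m) (sym (ℤ.pos-* k k)) A⇔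

  n≡2m : + suc n₀ ≡ + 2 * + m
  n≡2m = trans (cong +_ (trans n≡m*2 (ℕ.*-comm m 2))) (ℤ.pos-* 2 m)

  module Λ = Graph n₀ k m n≡2m (Equivalence.to ∣⇔≡0-mod 2∣k) plus
  module T = Graph n₀ k m n≡2m (Equivalence.to ∣⇔≡0-mod 2∣k) minus
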